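{- Let $G$ be a graph and $S \subseteq V(G)$. Then $S$ is a redundant locating-dominating (RED:LD) set of $G$ if and only if all of the following hold: (i) for every $v \in V(G)$, $|N[v] \cap S| \ge 2$; (ii) for every $v \in S$ and every $u \in V(G)-S$, $|((N(v) \cap S) \triangle (N(u) \cap S)) - \{v\}| \ge 1$; (iii) for all $u,v \in V(G)-S$ with $u \neq v$, $|(N(v) \cap S) \triangle (N(u) \cap S)| \ge 2$.
   Context: $N(v)$ denotes the open neighborhood of $v$ and $N[v]=N(v)\cup\{v\}$ the closed neighborhood; $\triangle$ is symmetric difference. A set $S \subseteq V(G)$ is a locating-dominating (LD) set if for all $u,v \in V(G)-S$: $N(v)\cap S \neq \varnothing$, and if $u \ne v$ then $N(v) \cap S \neq N(u) \cap S$. A redundant locating-dominating (RED:LD) set is an LD set $S$ such that for every $v \in S$, the set $S-\{v\}$ is also an LD set. -}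

module Defs where

open import Data.Nat using (ℕ)
open import Data.Fin using (Fin)
open import Data.Fin.Subset using (Subset; _∈_; _∉_; _∩_; _∪_; _─_; _-_; ⁅_⁆; Nonempty)
open import Data.Product using (_×_)
open import Relation.Binary.PropositionalEquality using (_≡_; _≢_)

record Graph (n : ℕ) : Set where
  field
    N     : Fin n → Subset n
    irrefl : ∀ v → v ∉ N v
    sym    : ∀ u v → u ∈ N v → v ∈ N u
open Graph public

N[_]_ : ∀ {n} → Graph n → Fin n → Subset n
N[ G ] v = N G v ∪ ⁅ v ⁆

_△_ : ∀ {n} → Subset n → Subset n → Subset n
A △ B = (A ─ B) ∪ (B ─ A)

IsLD : ∀ {n} → Graph n → Subset n → Set
IsLD G S =
  (∀ v → v ∉ S → Nonempty (N G v ∩ S)) ×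
  (∀ u v → u ∉ S → v ∉ S → u ≢ v → N G v ∩ S ≢ N G u ∩ S)

IsREDLD : ∀ {n} → Graph n → Subset n → Set
IsREDLD G S = IsLD G S × (∀ v → v ∈ S → IsLD G (S - v))

{-# OPTIONS --safe #-}
-- Deleting a vertex w from S can only break domination at a vertex whose closed
-- neighbourhood meets S in w alone, and can only break the separation of u, v ∉ S - w
-- when w is the only vertex of S telling N(u) ∩ S and N(v) ∩ S apart, or when w is
-- u or v itself; in the latter case w no longer counts in the symmetric difference.
-- Conditions (i)-(iii) are exactly the statements that none of this happens.
module Submission where

open import Defs
open import Data.Bool.Properties using (∧-zeroʳ)
open import Data.Empty using (⊥-elim)
open import Data.Fin using (Fin; _≟_)
open import Data.Fin.Subset
  using (Subset; _∈_; _∉_; _∩_; _─_; _-_; ∣_∣; ⁅_⁆; Nonempty; _⊆_; inside; outside; ⊥)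
open import Data.Fin.Subset.Properties
open import Data.Nat using (ℕ; _≥_; s≤s; z≤n)
open import Data.Nat.Properties using (≤-trans)
open import Data.Product using (_×_; _,_; proj₂)
open import Data.Sum using (inj₁; inj₂)
open import Data.Vec using (_∷_; []; tail; here; there)
open import Function.Bundles using (_⇔_; mk⇔; module Equivalence)
open Equivalence using (to; from)
open import Relation.Nullary using (yes; no; contradiction)
open import Relation.Binary.PropositionalEquality
  using (_≡_; _≢_; refl; cong; cong₂; subst; ≢-sym) renaming (sym to ≡-sym)

private
  variable
    n : ℕ
    p q : Subset n
    x y : Fin n

x∈p─q⇒x∉q : ∀ (p q : Subset n) → x ∈ p ─ q → x ∉ q
x∈p─q⇒x∉q (inside ∷ p) (outside ∷ q) here ()
x∈p─q⇒x∉q (_ ∷ p) (_ ∷ q) (there x∈p─q) (there x∈q) = x∈p─q⇒x∉q p q x∈p─q x∈q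

x∈p-y⇒x≢y : ∀ (p : Subset n) y → x ∈ p - y → x ≢ y
x∈p-y⇒x≢y p y x∈p-y = x∉⁅y⁆⇒x≢y (x∈p─q⇒x∉q p ⁅ y ⁆ x∈p-y)

x∉p-x : ∀ (p : Subset n) x → x ∉ p - x
x∉p-x p x x∈p-x = x∈p-y⇒x≢y p x x∈p-x refl

p∩[q─r]≡p∩q─r : ∀ (p q r : Subset n) → p ∩ (q ─ r) ≡ p ∩ q ─ r
p∩[q─r]≡p∩q─r [] [] [] = refl
p∩[q─r]≡p∩q─r (s ∷ p) (t ∷ q) (inside ∷ r) = cong₂ _∷_ (∧-zeroʳ s) (p∩[q─r]≡p∩q─r p q r)
p∩[q─r]≡p∩q─r (s ∷ p) (t ∷ q) (outside ∷ r) = cong (_ ∷_) (p∩[q─r]≡p∩q─r p q r)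

p△q─r≡[p─r]△[q─r] : ∀ (p q r : Subset n) → p △ q ─ r ≡ (p ─ r) △ (q ─ r)
p△q─r≡[p─r]△[q─r] [] [] [] = refl
p△q─r≡[p─r]△[q─r] (_ ∷ p) (_ ∷ q) (inside ∷ r) = cong (_ ∷_) (p△q─r≡[p─r]△[q─r] p q r)
p△q─r≡[p─r]△[q─r] (_ ∷ p) (_ ∷ q) (outside ∷ r) = cong (_ ∷_) (p△q─r≡[p─r]△[q─r] p q r)

p△p≡⊥ : ∀ (p : Subset n) → p △ p ≡ ⊥
p△p≡⊥ [] = refl
p△p≡⊥ (inside ∷ p) = cong (outside ∷_) (p△p≡⊥ p)
p△p≡⊥ (outside ∷ p) = cong (outside ∷_) (p△p≡⊥ p)

p△q≡⊥⇒p≡q : ∀ (p q : Subset n) → p △ q ≡ ⊥ → p ≡ q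
p△q≡⊥⇒p≡q [] [] _ = refl
p△q≡⊥⇒p≡q (inside ∷ p) (inside ∷ q) eq = cong (inside ∷_) (p△q≡⊥⇒p≡q p q (cong tail eq))
p△q≡⊥⇒p≡q (outside ∷ p) (outside ∷ q) eq = cong (outside ∷_) (p△q≡⊥⇒p≡q p q (cong tail eq))
p△q≡⊥⇒p≡q (inside ∷ p) (outside ∷ q) ()
p△q≡⊥⇒p≡q (outside ∷ p) (inside ∷ q) ()

p≢q⇔Nonempty[p△q] : p ≢ q ⇔ Nonempty (p △ q)
p≢q⇔Nonempty[p△q] {p = p} {q} = mk⇔ witness refute
  where
  witness : p ≢ q → Nonempty (p △ q)
  witness p≢q with nonempty? (p △ q)
  ... | yes ne = ne
  ... | no empty = contradiction (p△q≡⊥⇒p≡q p q (Empty-unique empty)) p≢q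
  refute : Nonempty (p △ q) → p ≢ q
  refute (x , x∈p△q) refl = ∉⊥ (subst (x ∈_) (p△p≡⊥ p) x∈p△q)

p∩[r-x]≢q∩[r-x]⇔Nonempty[[p∩r]△[q∩r]-x] : ∀ (p q r : Subset n) x →
  p ∩ (r - x) ≢ q ∩ (r - x) ⇔ Nonempty ((p ∩ r) △ (q ∩ r) - x)
p∩[r-x]≢q∩[r-x]⇔Nonempty[[p∩r]△[q∩r]-x] p q r x
  rewrite p∩[q─r]≡p∩q─r p r ⁅ x ⁆ | p∩[q─r]≡p∩q─r q r ⁅ x ⁆
        | p△q─r≡[p─r]△[q─r] (p ∩ r) (q ∩ r) ⁅ x ⁆
  = p≢q⇔Nonempty[p△q]

x∈[p∩r]△[q∩r]⇒x∈r : ∀ (p q r : Subset n) → x ∈ (p ∩ r) △ (q ∩ r) → x ∈ r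
x∈[p∩r]△[q∩r]⇒x∈r p q r x∈ with x∈p∪q⁻ _ _ x∈
... | inj₁ x∈p∩r─q∩r = proj₂ (x∈p∩q⁻ p r (p─q⊆p _ _ x∈p∩r─q∩r))
... | inj₂ x∈q∩r─p∩r = proj₂ (x∈p∩q⁻ q r (p─q⊆p _ _ x∈q∩r─p∩r))

Nonempty⇔∣p∣≥1 : Nonempty p ⇔ ∣ p ∣ ≥ 1
Nonempty⇔∣p∣≥1 {n} {p} = mk⇔ count witness
  where
  count : Nonempty p → ∣ p ∣ ≥ 1
  count (x , x∈p) = ≤-trans (s≤s z≤n) (x∈p⇒∣p-x∣<∣p∣ x∈p)
  witness : ∣ p ∣ ≥ 1 → Nonempty p
  witness ∣p∣≥1 with nonempty? p
  ... | yes ne = ne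
  ... | no empty = contradiction
    (subst (_≥ 1) (∣⊥∣≡0 n) (subst (λ r → ∣ r ∣ ≥ 1) (Empty-unique empty) ∣p∣≥1)) λ ()

∣p∣≥2⇒Nonempty[p-x] : ∀ x → ∣ p ∣ ≥ 2 → Nonempty (p - x)
∣p∣≥2⇒Nonempty[p-x] {p = p} x ∣p∣≥2 with nonempty? (p - x)
... | yes ne = ne
... | no empty = contradiction
  (subst (_≥ 2) (∣⁅x⁆∣≡1 x) (≤-trans ∣p∣≥2 (p⊆q⇒∣p∣≤∣q∣ p⊆⁅x⁆))) λ { (s≤s ()) }
  where
  p⊆⁅x⁆ : p ⊆ ⁅ x ⁆
  p⊆⁅x⁆ {y} y∈p with y ≟ x
  ... | yes refl = x∈⁅x⁆ x
  ... | no y≢x = ⊥-elim (empty (y , x∈p∧x≢y⇒x∈p-y y∈p y≢x))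

x∈p∧y∈p-x⇒∣p∣≥2 : x ∈ p → y ∈ p - x → ∣ p ∣ ≥ 2
x∈p∧y∈p-x⇒∣p∣≥2 x∈p y∈p-x =
  ≤-trans (s≤s (to Nonempty⇔∣p∣≥1 (_ , y∈p-x))) (x∈p⇒∣p-x∣<∣p∣ x∈p)

x∉p⇒x∉p-y : ∀ (p : Subset n) y → x ∉ p → x ∉ p - y
x∉p⇒x∉p-y p y x∉p x∈p-y = x∉p (p─q⊆p p ⁅ y ⁆ x∈p-y)

x∉p-y∧x≢y⇒x∉p : x ∉ p - y → x ≢ y → x ∉ p
x∉p-y∧x≢y⇒x∉p x∉p-y x≢y x∈p = x∉p-y (x∈p∧x≢y⇒x∈p-y x∈p x≢y)

module _ (G : Graph n) where

  IsLD⇒Nonempty[N[v]∩T] : ∀ {T} → IsLD G T → ∀ v → Nonempty (N[ G ] v ∩ T)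
  IsLD⇒Nonempty[N[v]∩T] {T} (dominates , _) v with v ∈? T
  ... | yes v∈T = v , x∈p∩q⁺ (x∈p∪q⁺ (inj₂ (x∈⁅x⁆ v)) , v∈T)
  ... | no v∉T with dominates v v∉T
  ...   | x , x∈Nv∩T with x∈p∩q⁻ (N G v) T x∈Nv∩T
  ...     | x∈Nv , x∈T = x , x∈p∩q⁺ (x∈p∪q⁺ (inj₁ x∈Nv) , x∈T)

  Nonempty[N[v]∩T]⇒Nonempty[Nv∩T] : ∀ {T v} → v ∉ T →
    Nonempty (N[ G ] v ∩ T) → Nonempty (N G v ∩ T)
  Nonempty[N[v]∩T]⇒Nonempty[Nv∩T] {T} {v} v∉T (x , x∈N[v]∩T)
    with x∈p∩q⁻ (N[ G ] v) T x∈N[v]∩T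
  ... | x∈N[v] , x∈T with x∈p∪q⁻ (N G v) ⁅ v ⁆ x∈N[v]
  ...   | inj₁ x∈Nv = x , x∈p∩q⁺ (x∈Nv , x∈T)
  ...   | inj₂ x∈⁅v⁆ = contradiction (subst (_∈ T) (x∈⁅y⁆⇒x≡y v x∈⁅v⁆) x∈T) v∉T

  module _ {S : Subset n} where

    IsLD[S-w]⇒Nonempty[[Nv∩S]△[Nu∩S]-w] : ∀ {w u v} → IsLD G (S - w) →
      u ∉ S - w → v ∉ S - w → u ≢ v → Nonempty ((N G v ∩ S) △ (N G u ∩ S) - w)
    IsLD[S-w]⇒Nonempty[[Nv∩S]△[Nu∩S]-w] {w} {u} {v} (_ , separates) u∉ v∉ u≢v =
      to (p∩[r-x]≢q∩[r-x]⇔Nonempty[[p∩r]△[q∩r]-x] (N G v) (N G u) S w)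
        (separates u v u∉ v∉ u≢v)

    IsREDLD⇒∣N[v]∩S∣≥2 : IsREDLD G S → ∀ v → ∣ N[ G ] v ∩ S ∣ ≥ 2
    IsREDLD⇒∣N[v]∩S∣≥2 (isLD , redundant) v with IsLD⇒Nonempty[N[v]∩T] isLD v
    ... | x , x∈N[v]∩S with IsLD⇒Nonempty[N[v]∩T] (redundant x (proj₂ (x∈p∩q⁻ _ S x∈N[v]∩S))) v
    ...   | y , y∈N[v]∩[S-x] =
      x∈p∧y∈p-x⇒∣p∣≥2 x∈N[v]∩S (subst (y ∈_) (p∩[q─r]≡p∩q─r (N[ G ] v) S ⁅ x ⁆) y∈N[v]∩[S-x])

    IsREDLD⇒∣[Nv∩S]△[Nu∩S]-v∣≥1 : IsREDLD G S →
      ∀ v u → v ∈ S → u ∉ S → ∣ (N G v ∩ S) △ (N G u ∩ S) - v ∣ ≥ 1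
    IsREDLD⇒∣[Nv∩S]△[Nu∩S]-v∣≥1 (_ , redundant) v u v∈S u∉S =
      to Nonempty⇔∣p∣≥1
        (IsLD[S-w]⇒Nonempty[[Nv∩S]△[Nu∩S]-w] (redundant v v∈S)
          (x∉p⇒x∉p-y S v u∉S) (x∉p-x S v) λ { refl → u∉S v∈S })

    IsREDLD⇒∣[Nv∩S]△[Nu∩S]∣≥2 : IsREDLD G S →
      ∀ u v → u ∉ S → v ∉ S → u ≢ v → ∣ (N G v ∩ S) △ (N G u ∩ S) ∣ ≥ 2
    IsREDLD⇒∣[Nv∩S]△[Nu∩S]∣≥2 ((_ , separates) , redundant) u v u∉S v∉S u≢v
      with to p≢q⇔Nonempty[p△q] (separates u v u∉S v∉S u≢v)
    ... | x , x∈ with IsLD[S-w]⇒Nonempty[[Nv∩S]△[Nu∩S]-w]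
                        (redundant x (x∈[p∩r]△[q∩r]⇒x∈r (N G v) (N G u) S x∈))
                        (x∉p⇒x∉p-y S x u∉S) (x∉p⇒x∉p-y S x v∉S) u≢v
    ...   | y , y∈ = x∈p∧y∈p-x⇒∣p∣≥2 x∈ y∈

    module _ (closed-≥2 : ∀ v → ∣ N[ G ] v ∩ S ∣ ≥ 2)
             (mixed-≥1 : ∀ v u → v ∈ S → u ∉ S → ∣ (N G v ∩ S) △ (N G u ∩ S) - v ∣ ≥ 1)
             (outside-≥2 : ∀ u v → u ∉ S → v ∉ S → u ≢ v → ∣ (N G v ∩ S) △ (N G u ∩ S) ∣ ≥ 2)
             where

      IsLD[S] : IsLD G S
      IsLD[S] = dominates , separates
        where
        dominates : ∀ v → v ∉ S → Nonempty (N G v ∩ S)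
        dominates v v∉S = Nonempty[N[v]∩T]⇒Nonempty[Nv∩T] v∉S
          (from Nonempty⇔∣p∣≥1 (≤-trans (s≤s z≤n) (closed-≥2 v)))
        separates : ∀ u v → u ∉ S → v ∉ S → u ≢ v → N G v ∩ S ≢ N G u ∩ S
        separates u v u∉S v∉S u≢v = from p≢q⇔Nonempty[p△q]
          (from Nonempty⇔∣p∣≥1 (≤-trans (s≤s z≤n) (outside-≥2 u v u∉S v∉S u≢v)))

      IsLD[S-w] : ∀ w → w ∈ S → IsLD G (S - w)
      IsLD[S-w] w w∈S = dominates , separates
        where
        dominates : ∀ v → v ∉ S - w → Nonempty (N G v ∩ (S - w))
        dominates v v∉ = Nonempty[N[v]∩T]⇒Nonempty[Nv∩T] v∉
          (subst Nonempty (≡-sym (p∩[q─r]≡p∩q─r (N[ G ] v) S ⁅ w ⁆))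
            (∣p∣≥2⇒Nonempty[p-x] w (closed-≥2 v)))
        separated-by : ∀ u v → Nonempty ((N G v ∩ S) △ (N G u ∩ S) - w) →
          N G v ∩ (S - w) ≢ N G u ∩ (S - w)
        separated-by u v = from
          (p∩[r-x]≢q∩[r-x]⇔Nonempty[[p∩r]△[q∩r]-x] (N G v) (N G u) S w)
        separates : ∀ u v → u ∉ S - w → v ∉ S - w → u ≢ v → N G v ∩ (S - w) ≢ N G u ∩ (S - w)
        separates u v u∉ v∉ u≢v with v ≟ w | u ≟ w
        ... | yes refl | _ = separated-by u v
          (from Nonempty⇔∣p∣≥1 (mixed-≥1 v u w∈S (x∉p-y∧x≢y⇒x∉p u∉ u≢v)))
        ... | no v≢w | yes refl = ≢-sym (separated-by v u
          (from Nonempty⇔∣p∣≥1 (mixed-≥1 u v w∈S (x∉p-y∧x≢y⇒x∉p v∉ v≢w))))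
        ... | no v≢w | no u≢w = separated-by u v (∣p∣≥2⇒Nonempty[p-x] w
          (outside-≥2 u v (x∉p-y∧x≢y⇒x∉p u∉ u≢w) (x∉p-y∧x≢y⇒x∉p v∉ v≢w) u≢v))

theorem2 : ∀ {n} (G : Graph n) (S : Subset n) →
    IsREDLD G S ⇔
      ((∀ v → ∣ (N[ G ] v) ∩ S ∣ ≥ 2) ×
       (∀ v u → v ∈ S → u ∉ S → ∣ ((N G v ∩ S) △ (N G u ∩ S)) - v ∣ ≥ 1) ×
       (∀ u v → u ∉ S → v ∉ S → u ≢ v → ∣ (N G v ∩ S) △ (N G u ∩ S) ∣ ≥ 2))
theorem2 G S = mk⇔
  (λ red → IsREDLD⇒∣N[v]∩S∣≥2 G red
         , IsREDLD⇒∣[Nv∩S]△[Nu∩S]-v∣≥1 G red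
         , IsREDLD⇒∣[Nv∩S]△[Nu∩S]∣≥2 G red)
  (λ { (closed-≥2 , mixed-≥1 , outside-≥2) →
         IsLD[S] G closed-≥2 mixed-≥1 outside-≥2 , IsLD[S-w] G closed-≥2 mixed-≥1 outside-≥2 })
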